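{- Let $n\in\mathbb{N}$, let $p$ be a prime factor of $n$ and let $\alpha$ be the largest integer with $p^{\alpha}\mid n$. Then for every integer $\beta$ with $1\le\beta\le\alpha$, $$\sum_{d\mid \frac{n}{p^{\beta}}}\phi\!\left(\frac{n}{d}\right)=n-\frac{n}{p^{\alpha-\beta+1}},$$ where the sum is over positive divisors $d$ of $n/p^{\beta}$.
   Context: $\phi$ is Euler's phi function. -}

module Defs where

open import Data.Nat using (ℕ; zero; suc; _+_; _/_)
open import Data.Nat.GCD using (gcd)
open import Data.Nat.Divisibility using (_∣?_)
open import Data.Nat.Properties using (_≟_)
open import Data.List using (List; map; filter; length)
open import Data.Nat.ListAction using (sum)
open import Data.List.Base using (upTo)

range1 : ℕ → List ℕ
range1 m = map suc (upTo m)

-- Euler's totient: φ m = #{ k ∈ [1..m] : gcd k m = 1 }  (φ 0 = 0, φ 1 = 1)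
φ : ℕ → ℕ
φ m = length (filter (λ k → gcd k m ≟ 1) (range1 m))

divisorSum : ℕ → (ℕ → ℕ) → ℕ
divisorSum m f = sum (map f (filter (λ d → d ∣? m) (range1 m)))

-- exact division n / d for d ≥ 1 (returns 0 when d = 0; only used with d ≠ 0)
_div_ : ℕ → ℕ → ℕ
n div zero = 0
n div suc d = n / suc d

module Submission where

-- Write n = m·p^α with p ∤ m, β = b+1 ≤ α, t = α − β, N = n/p^β = m·p^t and
-- Q = p^(t+1) = p^(α−β+1).  The proof is a counting argument in three steps.
--
--  (1) For every divisor N of n, grouping k ∈ [1..n] by the value of gcd(k,n):
--        Σ_{d ∣ N} φ(n/d) = #{ k ∈ [1..n] : gcd(k,n) ∣ N },
--      because φ(n/d) = #{ k ∈ [1..n] : gcd(k,n) = d } for d ∣ n.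
--  (2) For k ∈ [1..n]:  gcd(k,n) ∣ N  ⇔  Q ∤ k.  Stripping powers of p from a
--      divisor of m·p^α gives "⇐"; "⇒" holds because Q ∣ gcd(k,n) ∣ m·p^t
--      would force p ∣ m.
--  (3) #{ k ∈ [1..n] : Q ∤ k } = n − n/Q, since Q ∣ n.

open import Defs
open import Data.Nat
open import Data.Nat.Properties
open import Data.Nat.Divisibility
open import Data.Nat.GCD
open import Data.Nat.DivMod using (m*n/n≡m)
open import Data.Nat.Primality using (Prime; prime⇒irreducible; prime⇒nonZero)
open import Data.Nat.Coprimality using (Coprime; coprime-divisor)
open import Data.Nat.ListAction using (sum)
open import Data.Nat.ListAction.Properties using (sum-++)
open import Data.List using ([]; _∷_; _++_; [_]; map; filter; length; upTo)
open import Data.List.Properties using (map-++; upTo-∷ʳ)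
open import Data.Product using (_,_)
open import Data.Sum using (inj₁; inj₂)
open import Function.Bundles using (_⇔_; mk⇔; Equivalence)
open import Relation.Nullary using (¬_; Dec; yes; no; contradiction)
open import Relation.Nullary.Decidable using (¬?)
open import Relation.Unary using (Decidable)
open import Relation.Binary.PropositionalEquality hiding ([_])
open import Algebra.Properties.CommutativeSemigroup +-commutativeSemigroup using (interchange)

sumTo : ℕ → (ℕ → ℕ) → ℕ
sumTo zero    f = 0
sumTo (suc m) f = sumTo m f + f (suc m)

sumTo-congᵇ : ∀ m {f g : ℕ → ℕ} → (∀ k → 1 ≤ k → k ≤ m → f k ≡ g k) →
  sumTo m f ≡ sumTo m g
sumTo-congᵇ zero    eq = refl
sumTo-congᵇ (suc m) eq =
  cong₂ _+_ (sumTo-congᵇ m (λ k 1≤k k≤m → eq k 1≤k (m≤n⇒m≤1+n k≤m)))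
            (eq (suc m) (s≤s z≤n) ≤-refl)

sumTo-cong : ∀ m {f g : ℕ → ℕ} → (∀ k → f k ≡ g k) → sumTo m f ≡ sumTo m g
sumTo-cong m eq = sumTo-congᵇ m (λ k _ _ → eq k)

sumTo-zero : ∀ m → sumTo m (λ _ → 0) ≡ 0
sumTo-zero zero    = refl
sumTo-zero (suc m) = trans (+-identityʳ _) (sumTo-zero m)

sumTo-one : ∀ m → sumTo m (λ _ → 1) ≡ m
sumTo-one zero    = refl
sumTo-one (suc m) = trans (cong (_+ 1) (sumTo-one m)) (+-comm m 1)

sumTo-+ : ∀ m (f g : ℕ → ℕ) → sumTo m f + sumTo m g ≡ sumTo m (λ k → f k + g k)
sumTo-+ zero    f g = refl
sumTo-+ (suc m) f g =
  trans (interchange (sumTo m f) (f (suc m)) (sumTo m g) (g (suc m)))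
        (cong (_+ (f (suc m) + g (suc m))) (sumTo-+ m f g))

sumTo-swap : ∀ a b (h : ℕ → ℕ → ℕ) →
  sumTo a (λ i → sumTo b (h i)) ≡ sumTo b (λ j → sumTo a (λ i → h i j))
sumTo-swap zero    b h = sym (sumTo-zero b)
sumTo-swap (suc a) b h =
  trans (cong (_+ sumTo b (h (suc a))) (sumTo-swap a b h)) (sumTo-+ b _ _)

sumTo-split : ∀ a b (f : ℕ → ℕ) → sumTo (a + b) f ≡ sumTo a f + sumTo b (λ i → f (a + i))
sumTo-split a zero    f = trans (cong (λ x → sumTo x f) (+-identityʳ a)) (sym (+-identityʳ _))
sumTo-split a (suc b) f = begin
  sumTo (a + suc b) f                                  ≡⟨ cong (λ x → sumTo x f) (+-suc a b) ⟩
  sumTo (a + b) f + f (suc (a + b))                    ≡⟨ cong₂ _+_ (sumTo-split a b f) (cong f (sym (+-suc a b))) ⟩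
  sumTo a f + sumTo b (λ i → f (a + i)) + f (a + suc b) ≡⟨ +-assoc (sumTo a f) _ _ ⟩
  sumTo a f + sumTo (suc b) (λ i → f (a + i))          ∎
  where open ≡-Reasoning

when : {A : Set} → Dec A → ℕ → ℕ
when (yes _) x = x
when (no _)  _ = 0

𝟙 : {A : Set} → Dec A → ℕ
𝟙 a = when a 1

when-yes : ∀ {A : Set} (a : Dec A) {x} → A → when a x ≡ x
when-yes (yes _) _ = refl
when-yes (no ¬A) A = contradiction A ¬A

when-no : ∀ {A : Set} (a : Dec A) {x} → ¬ A → when a x ≡ 0
when-no (yes A) ¬A = contradiction A ¬A
when-no (no _)  _  = refl

when-⇔ : ∀ {A B : Set} (a : Dec A) (b : Dec B) {x} → A ⇔ B → when a x ≡ when b x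
when-⇔ a (yes B) A⇔B = when-yes a (Equivalence.from A⇔B B)
when-⇔ a (no ¬B) A⇔B = when-no a (λ A → ¬B (Equivalence.to A⇔B A))

when-cong : ∀ {A : Set} (a : Dec A) {x y} → (A → x ≡ y) → when a x ≡ when a y
when-cong (yes A) eq = eq A
when-cong (no _)  _  = refl

when-comm : ∀ {A B : Set} (a : Dec A) (b : Dec B) x → when a (when b x) ≡ when b (when a x)
when-comm (yes _) b x = refl
when-comm (no _)  (yes _) x = refl
when-comm (no _)  (no _)  x = refl

when-zero : ∀ {A : Set} (a : Dec A) → when a 0 ≡ 0
when-zero (yes _) = refl
when-zero (no _)  = refl

when-sumTo : ∀ {A : Set} (a : Dec A) m (f : ℕ → ℕ) →
  when a (sumTo m f) ≡ sumTo m (λ k → when a (f k))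
when-sumTo (yes _) m f = refl
when-sumTo (no _)  m f = sym (sumTo-zero m)

𝟙-complement : ∀ {A : Set} (a : Dec A) → 𝟙 a + 𝟙 (¬? a) ≡ 1
𝟙-complement (yes _) = refl
𝟙-complement (no _)  = refl

sumTo-select : ∀ {x} m (f : ℕ → ℕ) → 1 ≤ x →
  sumTo m (λ d → when (x ≟ d) (f d)) ≡ when (x ≤? m) (f x)
sumTo-select zero    f 1≤x = sym (when-no (_ ≤? 0) (<⇒≱ 1≤x))
sumTo-select {x} (suc m) f 1≤x with x ≟ suc m
... | yes refl = begin
  sumTo m (λ d → when (suc m ≟ d) (f d)) + f (suc m) ≡⟨ cong (_+ f (suc m)) (sumTo-select m f 1≤x) ⟩
  when (suc m ≤? m) (f (suc m)) + f (suc m)          ≡⟨ cong (_+ f (suc m)) (when-no (suc m ≤? m) (<⇒≱ ≤-refl)) ⟩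
  f (suc m)                                          ≡⟨ sym (when-yes (suc m ≤? suc m) ≤-refl) ⟩
  when (suc m ≤? suc m) (f (suc m))                  ∎
  where open ≡-Reasoning
... | no x≢1+m = trans (+-identityʳ _) (trans (sumTo-select m f 1≤x)
  (when-⇔ (x ≤? m) (x ≤? suc m) (mk⇔ m≤n⇒m≤1+n (λ x≤1+m → s≤s⁻¹ (≤∧≢⇒< x≤1+m x≢1+m)))))

sum-map-filter : ∀ {P : ℕ → Set} (P? : Decidable P) (f : ℕ → ℕ) xs →
  sum (map f (filter P? xs)) ≡ sum (map (λ x → when (P? x) (f x)) xs)
sum-map-filter P? f []       = refl
sum-map-filter P? f (x ∷ xs) with P? x
... | yes _ = cong (f x +_) (sum-map-filter P? f xs)
... | no _  = sum-map-filter P? f xs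

length-filter : ∀ {P : ℕ → Set} (P? : Decidable P) xs →
  length (filter P? xs) ≡ sum (map (λ x → 𝟙 (P? x)) xs)
length-filter P? []       = refl
length-filter P? (x ∷ xs) with P? x
... | yes _ = cong suc (length-filter P? xs)
... | no _  = length-filter P? xs

range1-snoc : ∀ m → range1 (suc m) ≡ range1 m ++ [ suc m ]
range1-snoc m = trans (cong (map suc) (sym (upTo-∷ʳ m))) (map-++ suc (upTo m) [ m ])

sum-range1 : ∀ m (f : ℕ → ℕ) → sum (map f (range1 m)) ≡ sumTo m f
sum-range1 zero    f = refl
sum-range1 (suc m) f = begin
  sum (map f (range1 (suc m)))                ≡⟨ cong (λ xs → sum (map f xs)) (range1-snoc m) ⟩
  sum (map f (range1 m ++ [ suc m ]))         ≡⟨ cong sum (map-++ f (range1 m) [ suc m ]) ⟩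
  sum (map f (range1 m) ++ [ f (suc m) ])     ≡⟨ sum-++ (map f (range1 m)) [ f (suc m) ] ⟩
  sum (map f (range1 m)) + (f (suc m) + 0)    ≡⟨ cong₂ _+_ (sum-range1 m f) (+-identityʳ _) ⟩
  sumTo (suc m) f                             ∎
  where open ≡-Reasoning

count : {P : ℕ → Set} → ℕ → Decidable P → ℕ
count m P? = sumTo m (λ k → 𝟙 (P? k))

count-cong : ∀ m {P Q : ℕ → Set} {P? : Decidable P} {Q? : Decidable Q} →
  (∀ k → P k ⇔ Q k) → count m P? ≡ count m Q?
count-cong m {P? = P?} {Q?} P⇔Q = sumTo-cong m (λ k → when-⇔ (P? k) (Q? k) (P⇔Q k))

count-complement : ∀ m {P : ℕ → Set} (P? : Decidable P) →
  count m P? + count m (λ k → ¬? (P? k)) ≡ m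
count-complement m P? =
  trans (sumTo-+ m _ _) (trans (sumTo-cong m (λ k → 𝟙-complement (P? k))) (sumTo-one m))

no-multiple-inside-block : ∀ d' j i → 1 ≤ i → i ≤ d' → ¬ (suc d' ∣ j * suc d' + i)
no-multiple-inside-block d' j i 1≤i i≤d' d∣ =
  <⇒≱ (s≤s i≤d') (∣⇒≤ {{>-nonZero 1≤i}} (∣m+n∣m⇒∣n d∣ (n∣m*n j)))

count-sampled : ∀ {P : ℕ → Set} (P? : Decidable P) d' → (∀ k → P k → suc d' ∣ k) →
  ∀ j → count (j * suc d') P? ≡ count j (λ i → P? (i * suc d'))
count-sampled P? d' onlyMultiples zero    = refl
count-sampled P? d' onlyMultiples (suc j) = begin
  count (d + j * d) P?                                 ≡⟨ cong (λ x → count x P?) (+-comm d (j * d)) ⟩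
  sumTo (j * d + d) f                                  ≡⟨ sumTo-split (j * d) d f ⟩
  sumTo (j * d) f + sumTo d (λ i → f (j * d + i))      ≡⟨ cong₂ _+_ (count-sampled P? d' onlyMultiples j) block ⟩
  count j (λ i → P? (i * d)) + 𝟙 (P? (suc j * d))      ∎
  where
  open ≡-Reasoning
  d = suc d'
  f : ℕ → ℕ
  f k = 𝟙 (P? k)
  block : sumTo d (λ i → f (j * d + i)) ≡ f (suc j * d)
  block = cong₂ _+_
    (trans (sumTo-congᵇ d' (λ i 1≤i i≤d' → when-no (P? _)
             (λ P[jd+i] → no-multiple-inside-block d' j i 1≤i i≤d' (onlyMultiples _ P[jd+i]))))
           (sumTo-zero d'))
    (cong f (+-comm (j * d) d))

count-multiples : ∀ q j → count (j * suc q) (suc q ∣?_) ≡ j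
count-multiples q j = trans (count-sampled (suc q ∣?_) q (λ _ q∣k → q∣k) j)
  (trans (sumTo-cong j (λ i → when-yes (suc q ∣? i * suc q) (n∣m*n i))) (sumTo-one j))

div-exact : ∀ a q .{{_ : NonZero q}} → (a * q) div q ≡ a
div-exact a (suc q) = m*n/n≡m a (suc q)

count-non-multiples : ∀ q .{{_ : NonZero q}} {n} → q ∣ n →
  count n (λ k → ¬? (q ∣? k)) ≡ n ∸ n div q
count-non-multiples (suc q) (divides j refl) = begin
  count n nonMultiple                               ≡⟨ sym (m+n∸m≡n (count n multiple) _) ⟩
  count n multiple + count n nonMultiple ∸ count n multiple
    ≡⟨ cong₂ _∸_ (count-complement n multiple) (count-multiples q j) ⟩
  n ∸ j                                             ≡⟨ cong (n ∸_) (sym (div-exact j (suc q))) ⟩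
  n ∸ n div suc q                                   ∎
  where
  open ≡-Reasoning
  n = j * suc q
  multiple : Decidable (suc q ∣_)
  multiple = suc q ∣?_
  nonMultiple : Decidable (λ k → ¬ (suc q ∣ k))
  nonMultiple k = ¬? (multiple k)

gcd-scaled≡⇔coprime : ∀ i e d' → (gcd (i * suc d') (e * suc d') ≡ suc d') ⇔ (gcd i e ≡ 1)
gcd-scaled≡⇔coprime i e d' = mk⇔
  (λ eq → *-cancelˡ-≡ (gcd i e) 1 d (trans scale (trans eq (sym (*-identityʳ d)))))
  (λ eq → trans (sym scale) (trans (cong (d *_) eq) (*-identityʳ d)))
  where
  d = suc d'
  scale : d * gcd i e ≡ gcd (i * d) (e * d)
  scale = trans (c*gcd[m,n]≡gcd[cm,cn] d i e) (cong₂ gcd (*-comm d i) (*-comm d e))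

-- φ(e) = #{ k ∈ [1..e·d] : gcd(k, e·d) = d }: such k are exactly the i·d with
-- i ∈ [1..e] coprime to e.
φ-as-gcd-count : ∀ e d' → φ e ≡ count (e * suc d') (λ k → gcd k (e * suc d') ≟ suc d')
φ-as-gcd-count e d' = begin
  φ e                                                  ≡⟨ length-filter (λ i → gcd i e ≟ 1) (range1 e) ⟩
  sum (map (λ i → 𝟙 (gcd i e ≟ 1)) (range1 e))         ≡⟨ sum-range1 e _ ⟩
  count e (λ i → gcd i e ≟ 1)                          ≡⟨ count-cong e (λ i → gcd-scaled≡⇔coprime i e d') ⟨
  count e (λ i → gcd (i * d) (e * d) ≟ d)              ≡⟨ count-sampled (λ k → gcd k (e * d) ≟ d) d'
                                                            (λ k eq → subst (_∣ k) eq (gcd[m,n]∣m k _)) e ⟨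
  count (e * d) (λ k → gcd k (e * d) ≟ d)              ∎
  where
  open ≡-Reasoning
  d = suc d'

-- For d ∣ n:  φ(n/d) = #{ k ∈ [1..n] : gcd(k, n) = d }  (for d = 0 both sides are 0).
φ-cofactor : ∀ {n d} → d ∣ n → φ (n div d) ≡ count n (λ k → gcd k n ≟ d)
φ-cofactor {d = zero}   (divides q refl) rewrite *-zeroʳ q = refl
φ-cofactor {d = suc d'} (divides e refl) =
  trans (cong φ (div-exact e (suc d'))) (φ-as-gcd-count e d')

divisor-indicator : ∀ {x N} → 1 ≤ x → 1 ≤ N →
  sumTo N (λ d → when (d ∣? N) (𝟙 (x ≟ d))) ≡ 𝟙 (x ∣? N)
divisor-indicator {x} {N} 1≤x 1≤N =
  trans (sumTo-cong N (λ d → when-comm (d ∣? N) (x ≟ d) 1))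
        (trans (sumTo-select N (λ d → 𝟙 (d ∣? N)) 1≤x) in-range)
  where
  in-range : when (x ≤? N) (𝟙 (x ∣? N)) ≡ 𝟙 (x ∣? N)
  in-range with x ∣? N
  ... | yes x∣N = when-yes (x ≤? N) (∣⇒≤ {{>-nonZero 1≤N}} x∣N)
  ... | no _    = when-zero (x ≤? N)

divisorSum-φ : ∀ {n N} → 1 ≤ n → N ∣ n →
  divisorSum N (λ d → φ (n div d)) ≡ count n (λ k → gcd k n ∣? N)
divisorSum-φ {n} {N} 1≤n N∣n = begin
  divisorSum N (λ d → φ (n div d))
    ≡⟨ trans (sum-map-filter (_∣? N) _ (range1 N)) (sum-range1 N _) ⟩
  sumTo N (λ d → when (d ∣? N) (φ (n div d)))
    ≡⟨ sumTo-cong N (λ d → when-cong (d ∣? N) (λ d∣N → φ-cofactor (∣-trans d∣N N∣n))) ⟩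
  sumTo N (λ d → when (d ∣? N) (count n (λ k → gcd k n ≟ d)))
    ≡⟨ sumTo-cong N (λ d → when-sumTo (d ∣? N) n _) ⟩
  sumTo N (λ d → sumTo n (λ k → when (d ∣? N) (𝟙 (gcd k n ≟ d))))
    ≡⟨ sumTo-swap N n _ ⟩
  sumTo n (λ k → sumTo N (λ d → when (d ∣? N) (𝟙 (gcd k n ≟ d))))
    ≡⟨ sumTo-cong n (λ k → divisor-indicator (gcd≥1 k) 1≤N) ⟩
  count n (λ k → gcd k n ∣? N) ∎
  where
  open ≡-Reasoning
  n≢0 : n ≢ 0
  n≢0 = n>0⇒n≢0 1≤n
  1≤N : 1 ≤ N
  1≤N = n≢0⇒n>0 (λ { refl → n≢0 (0∣⇒≡0 N∣n) })
  gcd≥1 : ∀ k → 1 ≤ gcd k n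
  gcd≥1 k = n≢0⇒n>0 (λ eq → n≢0 (gcd[m,n]≡0⇒n≡0 k eq))

prime∤⇒coprime : ∀ {p g} → Prime p → ¬ (p ∣ g) → Coprime g p
prime∤⇒coprime pr p∤g (c∣g , c∣p) with prime⇒irreducible pr c∣p
... | inj₁ c≡1 = c≡1
... | inj₂ refl = contradiction c∣g p∤g

shift-power : ∀ M p e → M * p ^ suc e ≡ M * p ^ e * p
shift-power M p e = trans (cong (M *_) (*-comm p (p ^ e))) (sym (*-assoc M (p ^ e) p))

-- Peel off one factor p at a time: if p ∤ g it is coprime to the
-- factor, and if p ∣ g, cancel p from g and from the bound on the exponent.
strip-prime-power : ∀ {p} → Prime p → ∀ M u t g →
  g ∣ M * p ^ (u + t) → ¬ (p ^ suc t ∣ g) → g ∣ M * p ^ t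
strip-prime-power pr M zero t g g∣ _ = g∣
strip-prime-power {p} pr M (suc u) t g g∣ p^t+1∤g with p ∣? g
... | no p∤g = strip-prime-power pr M u t g
      (coprime-divisor (prime∤⇒coprime pr p∤g)
        (subst (g ∣_) (trans (shift-power M p (u + t)) (*-comm _ p)) g∣))
      p^t+1∤g
strip-prime-power pr M (suc u) zero g g∣ p^1∤g | yes p∣g =
  contradiction (subst (_∣ g) (sym (*-identityʳ _)) p∣g) p^1∤g
strip-prime-power {p} pr M (suc u) (suc t) .(g₁ * p) g∣ p^t+2∤g | yes (divides g₁ refl) =
  subst (g₁ * p ∣_) (sym (shift-power M p t)) (*-monoˡ-∣ p g₁∣M·p^t)
  where
  instance
    p≢0 : NonZero p
    p≢0 = prime⇒nonZero pr
  g₁∣ : g₁ ∣ M * p ^ (suc u + t)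
  g₁∣ = *-cancelʳ-∣ p (subst (g₁ * p ∣_)
          (trans (cong (λ e → M * p ^ e) (+-suc (suc u) t)) (shift-power M p (suc u + t))) g∣)
  p^t+1∤g₁ : ¬ (p ^ suc t ∣ g₁)
  p^t+1∤g₁ p^t+1∣g₁ = p^t+2∤g (subst (_∣ g₁ * p) (*-comm _ p) (*-monoˡ-∣ p p^t+1∣g₁))
  g₁∣M·p^t : g₁ ∣ M * p ^ t
  g₁∣M·p^t = strip-prime-power pr M (suc u) t g₁ g₁∣ p^t+1∤g₁

prime-power∣ : ∀ m p b t → p ^ suc t ∣ m * p ^ (suc b + t)
prime-power∣ m p b t = ∣-trans
  (divides (p ^ b) (trans (cong (p ^_) (sym (+-suc b t))) (^-distribˡ-+-* p b (suc t))))
  (n∣m*n m)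

gcd∣cofactor⇔ : ∀ {p m} b t k → Prime p → ¬ (p ∣ m) →
  (gcd k (m * p ^ (suc b + t)) ∣ m * p ^ t) ⇔ (¬ p ^ suc t ∣ k)
gcd∣cofactor⇔ {p} {m} b t k pr p∤m = mk⇔
  (λ g∣N Q∣k → p∤m (*-cancelʳ-∣ (p ^ t) {{m^n≢0 p t}}
     (∣-trans (gcd-greatest Q∣k (prime-power∣ m p b t)) g∣N)))
  (λ Q∤k → strip-prime-power pr m (suc b) t g (gcd[m,n]∣n k _)
     (λ Q∣g → Q∤k (∣-trans Q∣g (gcd[m,n]∣m k _))))
  where
  instance
    p≢0 : NonZero p
    p≢0 = prime⇒nonZero pr
  g = gcd k (m * p ^ (suc b + t))

lemma6p3 : (n p α β : ℕ) → 1 ≤ n → Prime p → p ∣ n →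
    p ^ α ∣ n → ¬ (p ^ suc α ∣ n) →
    1 ≤ β → β ≤ α →
    divisorSum (n div (p ^ β)) (λ d → φ (n div d))
      ≡ n ∸ n div (p ^ (α ∸ β + 1))
lemma6p3 n p α (suc b) 1≤n pr _ (divides m refl) p^α+1∤n _ β≤α
  with t , refl ← m≤n⇒∃[o]m+o≡n β≤α = begin
  divisorSum (n div (p ^ β)) F    ≡⟨ cong (λ x → divisorSum x F) n/p^β≡N ⟩
  divisorSum N F                  ≡⟨ divisorSum-φ 1≤n N∣n ⟩
  count n (λ k → gcd k n ∣? N)    ≡⟨ count-cong n (λ k → gcd∣cofactor⇔ b t k pr p∤m) ⟩
  count n (λ k → ¬? (Q ∣? k))     ≡⟨ count-non-multiples Q {{m^n≢0 p (suc t)}} (prime-power∣ m p b t) ⟩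
  n ∸ n div Q                     ≡⟨ cong (λ e → n ∸ n div (p ^ e)) (+-comm 1 t) ⟩
  n ∸ n div (p ^ (t + 1))         ≡⟨ cong (λ e → n ∸ n div (p ^ (e + 1))) (m+n∸m≡n β t) ⟨
  n ∸ n div (p ^ (β + t ∸ β + 1)) ∎
  where
  open ≡-Reasoning
  instance
    p≢0 : NonZero p
    p≢0 = prime⇒nonZero pr
  β = suc b
  N = m * p ^ t
  Q = p ^ suc t
  F : ℕ → ℕ
  F d = φ (n div d)
  p∤m : ¬ (p ∣ m)
  p∤m p∣m = p^α+1∤n (*-monoˡ-∣ (p ^ (β + t)) p∣m)
  n≡N·p^β : n ≡ N * p ^ β
  n≡N·p^β = begin
    m * p ^ (β + t)     ≡⟨ cong (m *_) (trans (^-distribˡ-+-* p β t) (*-comm (p ^ β) (p ^ t))) ⟩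
    m * (p ^ t * p ^ β) ≡⟨ *-assoc m (p ^ t) (p ^ β) ⟨
    N * p ^ β           ∎
  n/p^β≡N : n div (p ^ β) ≡ N
  n/p^β≡N = trans (cong (_div (p ^ β)) n≡N·p^β) (div-exact N (p ^ β) {{m^n≢0 p β}})
  N∣n : N ∣ n
  N∣n = subst (N ∣_) (sym n≡N·p^β) (m∣m*n (p ^ β))
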